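{- Let $D$ be a signed digraph on $[n]$. For every $x\in\{0,1\}^n$, the degree of $x$ in the guessing graph $\mathrm{G}(D,2)$ is \[ d(x)=\sum_{\substack{\emptyset\ne I\subseteq [n]\\ D[I]\text{ is $x$-frustrated}}}(-1)^{|I|-1}\,2^{\,n-|N(I)\cup I|+|N(I,x)|}. \]
   Context: A signed digraph on $[n]=\{0,\dots,n-1\}$ is $D=([n],E,\lambda)$ with $E\subseteq[n]\times[n]$ (loops allowed) and $\lambda:E\to\{ -1,0,1\}$. For $i\in[n]$, $N^\alpha(i)=\{j:(j,i)\in E,\lambda(j,i)=\alpha\}$, $N(i)$ is their union, and for $I\subseteq[n]$, $N(I)=\bigcup_{i\in I}N(i)$. $F(D,2)$ is the set of maps $f:\{0,1\}^n\to\{0,1\}^n$ such that each $f_i$ depends only on $x_{N(i)}$, is non-decreasing in $x_j$ when $\lambda(j,i)=1$ and non-increasing in $x_j$ when $\lambda(j,i)=-1$. The guessing graph $\mathrm{G}(D,2)$ is the simple graph on $\{0,1\}^n$ where distinct $x,y$ are adjacent iff no $f\in F(D,2)$ has both $x$ and $y$ as fixed points. For $x\in\{0,1\}^n$, an arc $(j,i)$ is $x$-frustrated if ($x_j\ne x_i$ and $\lambda(j,i)=1$) or ($x_j=x_i$ and $\lambda(j,i)=-1$). $D[I]$ denotes the subgraph induced by $I$, and it is $x$-frustrated if all its arcs are. $N(I,x)$ is the set of vertices $j\in N(I)\setminus I$ such that all arcs from $j$ to vertices of $I$ are $x$-frustrated. -}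

module Defs where

open import Data.Nat using (ℕ; zero; suc; _∸_; _+_) renaming (_^_ to _^ℕ_)
open import Data.Integer using (ℤ; +_; -1ℤ; _*_) renaming (_+_ to _+ℤ_; _^_ to _^ℤ_)
open import Data.Bool using (Bool; true; false; _∧_; _∨_; not; _xor_; if_then_else_)
import Data.Bool as B
open import Data.Maybe using (Maybe; just; nothing)
open import Data.Fin using (Fin)
open import Data.Vec using (Vec; []; _∷_; lookup; tabulate; _[_]≔_)
open import Data.List using (List; []; _∷_; _++_; map; allFin; foldr; length)
open import Data.Bool.ListAction using (all; any)
open import Data.Fin.Subset using (Subset; ∣_∣; _∪_)
open import Data.Product using (Σ; _×_)
open import Relation.Nullary using (¬_)
open import Relation.Binary.PropositionalEquality using (_≡_; _≢_)
open import Data.List.Relation.Unary.Unique.Propositional using (Unique)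
open import Data.List.Membership.Propositional using (_∈_)
open import Function.Bundles using (_⇔_)

data Sign : Set where
  neg zer pos : Sign

-- A signed digraph on [n]: D j i = nothing if (j,i) ∉ E, and just λ(j,i) otherwise.
SignedDigraph : ℕ → Set
SignedDigraph n = Fin n → Fin n → Maybe Sign

Config : ℕ → Set
Config n = Vec Bool n

isArc : ∀ {n} → SignedDigraph n → Fin n → Fin n → Bool
isArc D j i with D j i
... | nothing = false
... | just _  = true

InN : ∀ {n} → SignedDigraph n → Fin n → Fin n → Set
InN D i j = isArc D j i ≡ true

InF : ∀ {n} → SignedDigraph n → (Config n → Config n) → Set
InF {n} D f =
  (∀ (i : Fin n) (x y : Config n) →
     (∀ j → InN D i j → lookup x j ≡ lookup y j) →
     lookup (f x) i ≡ lookup (f y) i)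
  × (∀ (i j : Fin n) (x : Config n) → D j i ≡ just pos →
       lookup (f (x [ j ]≔ false)) i B.≤ lookup (f (x [ j ]≔ true)) i)
  × (∀ (i j : Fin n) (x : Config n) → D j i ≡ just neg →
       lookup (f (x [ j ]≔ true)) i B.≤ lookup (f (x [ j ]≔ false)) i)

Adjacent : ∀ {n} → SignedDigraph n → Config n → Config n → Set
Adjacent {n} D x y =
  x ≢ y × ¬ (Σ (Config n → Config n) λ f → InF D f × f x ≡ x × f y ≡ y)

HasDegree : ∀ {n} → SignedDigraph n → Config n → ℕ → Set
HasDegree {n} D x k =
  Σ (List (Config n)) λ ys →
    Unique ys × (∀ y → (y ∈ ys) ⇔ Adjacent D x y) × length ys ≡ k

frustSign : Sign → Bool → Bool → Bool
frustSign pos a b = a xor b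
frustSign neg a b = not (a xor b)
frustSign zer a b = false

okArc : ∀ {n} → SignedDigraph n → Config n → Fin n → Fin n → Bool
okArc D x j i with D j i
... | nothing = true
... | just s  = frustSign s (lookup x j) (lookup x i)

allF : ∀ {n} → (Fin n → Bool) → Bool
allF {n} p = all p (allFin n)

anyF : ∀ {n} → (Fin n → Bool) → Bool
anyF {n} p = any p (allFin n)

inducedFrustrated : ∀ {n} → SignedDigraph n → Config n → Subset n → Bool
inducedFrustrated D x I =
  allF λ j → allF λ i → not (lookup I j ∧ lookup I i) ∨ okArc D x j i

NSet : ∀ {n} → SignedDigraph n → Subset n → Subset n
NSet D I = tabulate λ j → anyF λ i → lookup I i ∧ isArc D j i

NSetX : ∀ {n} → SignedDigraph n → Subset n → Config n → Subset n
NSetX D I x = tabulate λ j →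
  not (lookup I j) ∧ lookup (NSet D I) j ∧
  (allF λ i → not (lookup I i) ∨ okArc D x j i)

nonemptyᵇ : ∀ {n} → Subset n → Bool
nonemptyᵇ I = anyF λ i → lookup I i

allSubsets : ∀ n → List (Subset n)
allSubsets zero = [] ∷ []
allSubsets (suc n) = map (false ∷_) (allSubsets n) ++ map (true ∷_) (allSubsets n)

term : ∀ {n} → SignedDigraph n → Config n → Subset n → ℤ
term {n} D x I =
  (-1ℤ ^ℤ (∣ I ∣ ∸ 1)) * (+ (2 ^ℕ ((n ∸ ∣ NSet D I ∪ I ∣) + ∣ NSetX D I x ∣)))

degreeFormula : ∀ {n} → SignedDigraph n → Config n → ℤ
degreeFormula D x =
  foldr (λ I acc →
           (if nonemptyᵇ I ∧ inducedFrustrated D x I then term D x I else + 0) +ℤ acc)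
        (+ 0) (allSubsets _)

module Submission where

-- Fix x.  For a configuration y let Δ(y) be the set of coordinates where
-- y differs from x, and call i a certificate for y if i ∈ Δ(y) and every
-- arc (j,i) with j ∈ Δ(y) is x-frustrated; S(y) is the set of certificates.
--
--  (1) y is adjacent to x iff S(y) ≠ ∅.  If i ∈ S(y), every f ∈ F(D,2)
--      fixing x and y gives a contradiction: walking from x towards y along
--      the in-neighbours of i, each frustrated arc can only pull f_i towards
--      x_i, yet f_i must reach y_i ≠ x_i.  If S(y) = ∅, every i ∈ Δ(y) has a
--      non-frustrated arc (j,i) with j ∈ Δ(y); the map whose i-th
--      coordinate copies or negates its input z_j, as the sign of the arc
--      allows, so that x_j ↦ x_i, lies in F(D,2) and fixes both x and y.
--  (2) Inclusion–exclusion: [S ≠ ∅] = Σ_{∅≠I⊆S} (-1)^{|I|-1}, so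
--      d(x) = Σ_{I≠∅} (-1)^{|I|-1} #{y : I ⊆ S(y)}.
--  (3) The configurations y with I ⊆ S(y) form a product set: y_j is forced
--      to flip on I, is free outside N(I) ∪ I and on N(I,x), and is fixed
--      elsewhere; the set is nonempty iff D[I] is x-frustrated.  Hence
--      #{y : I ⊆ S(y)} = [D[I] x-frustrated] 2^{n-|N(I)∪I|+|N(I,x)|}.

open import Defs
open import Data.Nat using (ℕ; zero; suc; _∸_) renaming (_+_ to _+ℕ_; _^_ to _^ℕ_)
import Data.Nat.Properties as ℕ
open import Data.Integer using (ℤ; +_; -1ℤ; _*_; -_) renaming (_+_ to _+ℤ_; _^_ to _^ℤ_)
open import Data.Integer.Properties
  using (+-identityˡ; +-identityʳ; +-assoc; +-inverseʳ; *-identityˡ; *-zeroʳ; *-assoc;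
         *-distribˡ-+; *-distribʳ-+; -1*i≡-i; pos-*; +-commutativeSemigroup)
open import Algebra.Properties.CommutativeSemigroup +-commutativeSemigroup using (interchange)
open import Data.Bool using (Bool; true; false; _∧_; _∨_; not; _xor_; if_then_else_)
import Data.Bool as B
open import Data.Bool.Properties
  using (⇔→≡; T-≡; xor-same; xor-assoc; not-distribˡ-xor; ∧-conicalˡ; ∧-conicalʳ)
  renaming (≤-refl to ≤ᵇ-refl; ≤-trans to ≤ᵇ-trans; ≤-reflexive to ≤ᵇ-reflexive)
import Data.Bool.Properties as Bool
open import Data.Bool.ListAction using (and; or)
open import Data.Fin using (Fin; zero; suc)
import Data.Fin.Properties as Fin
open import Data.Fin.Subset using (Subset; ∣_∣; _∪_; ∁)
open import Data.Fin.Subset.Properties using (∣∁p∣≡n∸∣p∣)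
open import Data.Vec using (Vec; []; _∷_; lookup; tabulate; _[_]≔_)
open import Data.Vec.Properties
  using (lookup∘tabulate; tabulate∘lookup; tabulate-cong; lookup-map; lookup-zipWith;
         lookup∘update; lookup∘update′)
open import Data.List using (List; []; _∷_; _++_; map; foldr; length; filterᵇ)
open import Data.List.Properties using (map-tabulate)
open import Data.List.Membership.Propositional using (_∈_)
open import Data.List.Membership.Propositional.Properties
  using (∈-map⁺; ∈-map⁻; ∈-++⁺ˡ; ∈-++⁺ʳ; ∈-filter⁺; ∈-filter⁻)
open import Data.List.Relation.Unary.Any using (here)
open import Data.List.Relation.Unary.AllPairs using ([]; _∷_)
open import Data.List.Relation.Unary.All using () renaming ([] to []ᴬ)
open import Data.List.Relation.Unary.Unique.Propositional using (Unique)
import Data.List.Relation.Unary.Unique.Propositional.Properties as Unique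
open import Data.Maybe using (just; nothing)
open import Data.Product using (Σ; _×_; _,_; proj₁; proj₂)
open import Data.Sum using (_⊎_; inj₁; inj₂)
open import Data.Unit using (⊤; tt)
open import Data.Empty using (⊥-elim)
open import Function using (_∘_; id; _⇔_; mk⇔; Equivalence)
open import Relation.Nullary using (¬_; yes; no)
open import Relation.Nullary.Decidable using (T?)
open import Relation.Binary.PropositionalEquality

⇒ᵇ-intro : ∀ {a b} → (a ≡ true → b ≡ true) → not a ∨ b ≡ true
⇒ᵇ-intro {true}  f = f refl
⇒ᵇ-intro {false} f = refl

⇒ᵇ-elim : ∀ {a b} → not a ∨ b ≡ true → a ≡ true → b ≡ true
⇒ᵇ-elim h refl = h

∧-intro : ∀ {a b} → a ≡ true → b ≡ true → a ∧ b ≡ true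
∧-intro refl refl = refl

∧-falseʳ : ∀ {a b} → a ≡ true → a ∧ b ≡ false → b ≡ false
∧-falseʳ refl h = h

⇒ᵇ-fails : ∀ a b c → not (a ∧ b) ∨ c ≡ false → a ≡ true × b ≡ true × c ≡ false
⇒ᵇ-fails true  true  false _ = refl , refl , refl
⇒ᵇ-fails true  true  true  ()
⇒ᵇ-fails true  false c     ()
⇒ᵇ-fails false b     c     ()

xor⇒flipped : ∀ {a b} → a xor b ≡ true → b ≡ not a
xor⇒flipped {true}  {false} _ = refl
xor⇒flipped {false} {true}  _ = refl

xor⇒≡ : ∀ {a b} → a xor b ≡ false → a ≡ b
xor⇒≡ {true}  {true}  _ = refl
xor⇒≡ {false} {false} _ = refl

xor-cancelˡ : ∀ a b → a xor (a xor b) ≡ b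
xor-cancelˡ a b = trans (sym (xor-assoc a a b)) (cong (_xor b) (xor-same a))

not-antitone : ∀ {a b} → a B.≤ b → not b B.≤ not a
not-antitone {false} {false} _ = ≤ᵇ-refl
not-antitone {false} {true}  _ = B.f≤t
not-antitone {true}  {true}  _ = ≤ᵇ-refl

true≰false : ¬ (true B.≤ false)
true≰false ()

χ : Bool → ℤ
χ true  = + 1
χ false = + 0

χ-∧ : ∀ a b → χ (a ∧ b) ≡ χ a * χ b
χ-∧ true  b = sym (*-identityˡ (χ b))
χ-∧ false b = refl

allF-suc : ∀ {n} (p : Fin (suc n) → Bool) → allF p ≡ p zero ∧ allF (p ∘ suc)
allF-suc p = trans (cong and (map-tabulate id p))
                   (cong (p zero ∧_) (sym (cong and (map-tabulate id (p ∘ suc)))))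

anyF-suc : ∀ {n} (p : Fin (suc n) → Bool) → anyF p ≡ p zero ∨ anyF (p ∘ suc)
anyF-suc p = trans (cong or (map-tabulate id p))
                   (cong (p zero ∨_) (sym (cong or (map-tabulate id (p ∘ suc)))))

allF-elim : ∀ {n} (p : Fin n → Bool) → allF p ≡ true → ∀ i → p i ≡ true
allF-elim p h zero    = ∧-conicalˡ _ _ (trans (sym (allF-suc p)) h)
allF-elim p h (suc i) = allF-elim (p ∘ suc) (∧-conicalʳ _ _ (trans (sym (allF-suc p)) h)) i

allF-intro : ∀ {n} (p : Fin n → Bool) → (∀ i → p i ≡ true) → allF p ≡ true
allF-intro {zero}  p h = refl
allF-intro {suc n} p h = trans (allF-suc p) (∧-intro (h zero) (allF-intro (p ∘ suc) (h ∘ suc)))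

allF-counterexample : ∀ {n} (p : Fin n → Bool) → allF p ≡ false → Σ (Fin n) λ i → p i ≡ false
allF-counterexample {suc n} p h with p zero in p₀ | trans (sym (allF-suc p)) h
... | false | _    = zero , p₀
... | true  | rest = let (i , pᵢ) = allF-counterexample (p ∘ suc) rest in suc i , pᵢ

anyF-witness : ∀ {n} (p : Fin n → Bool) → anyF p ≡ true → Σ (Fin n) λ i → p i ≡ true
anyF-witness {suc n} p h with p zero in p₀ | trans (sym (anyF-suc p)) h
... | true  | _    = zero , p₀
... | false | rest = let (i , pᵢ) = anyF-witness (p ∘ suc) rest in suc i , pᵢ

anyF-intro : ∀ {n} (p : Fin n → Bool) (i : Fin n) → p i ≡ true → anyF p ≡ true
anyF-intro p zero    h = trans (anyF-suc p) (cong (_∨ anyF (p ∘ suc)) h)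
anyF-intro p (suc i) h = trans (anyF-suc p) (trans (cong (p zero ∨_) (anyF-intro (p ∘ suc) i h))
                                                   (Bool.∨-zeroʳ (p zero)))

anyF-none : ∀ {n} (p : Fin n → Bool) → anyF p ≡ false → ∀ i → p i ≡ false
anyF-none p h i with p i in pᵢ
... | false = refl
... | true  = trans (sym (anyF-intro p i pᵢ)) h

count-split : ∀ {n} (p q : Fin n → Bool) →
  ∣ tabulate p ∣ ≡ ∣ tabulate (λ j → p j ∧ q j) ∣ +ℕ ∣ tabulate (λ j → p j ∧ not (q j)) ∣
count-split {zero}  p q = refl
count-split {suc n} p q with p zero | q zero
... | true  | true  = cong suc (count-split (p ∘ suc) (q ∘ suc))
... | true  | false = trans (cong suc (count-split (p ∘ suc) (q ∘ suc))) (sym (ℕ.+-suc _ _))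
... | false | true  = count-split (p ∘ suc) (q ∘ suc)
... | false | false = count-split (p ∘ suc) (q ∘ suc)

count-complement : ∀ {n} (U : Subset n) → ∣ tabulate (not ∘ lookup U) ∣ ≡ n ∸ ∣ U ∣
count-complement {n} U = begin
  ∣ tabulate (not ∘ lookup U) ∣ ≡⟨ cong ∣_∣ (tabulate-cong λ j → sym (lookup-map j not U)) ⟩
  ∣ tabulate (lookup (∁ U)) ∣   ≡⟨ cong ∣_∣ (tabulate∘lookup (∁ U)) ⟩
  ∣ ∁ U ∣                       ≡⟨ ∣∁p∣≡n∸∣p∣ U ⟩
  n ∸ ∣ U ∣                     ∎
  where open ≡-Reasoning

∑ : {A : Set} → List A → (A → ℤ) → ℤ
∑ []       f = + 0
∑ (a ∷ as) f = f a +ℤ ∑ as f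

module _ {A : Set} where

  ∑-cong : ∀ (xs : List A) {f g : A → ℤ} → (∀ a → f a ≡ g a) → ∑ xs f ≡ ∑ xs g
  ∑-cong []       h = refl
  ∑-cong (a ∷ as) h = cong₂ _+ℤ_ (h a) (∑-cong as h)

  ∑-zero : ∀ (xs : List A) → ∑ xs (λ _ → + 0) ≡ + 0
  ∑-zero []       = refl
  ∑-zero (a ∷ as) = trans (+-identityˡ _) (∑-zero as)

  ∑-scale : ∀ c (xs : List A) (f : A → ℤ) → ∑ xs (λ a → c * f a) ≡ c * ∑ xs f
  ∑-scale c []       f = sym (*-zeroʳ c)
  ∑-scale c (a ∷ as) f = trans (cong (c * f a +ℤ_) (∑-scale c as f)) (sym (*-distribˡ-+ c (f a) _))

  ∑-+ : ∀ (xs : List A) (f g : A → ℤ) → ∑ xs (λ a → f a +ℤ g a) ≡ ∑ xs f +ℤ ∑ xs g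
  ∑-+ []       f g = refl
  ∑-+ (a ∷ as) f g = trans (cong (f a +ℤ g a +ℤ_) (∑-+ as f g)) (interchange (f a) (g a) (∑ as f) (∑ as g))

  ∑-++ : ∀ (xs ys : List A) (f : A → ℤ) → ∑ (xs ++ ys) f ≡ ∑ xs f +ℤ ∑ ys f
  ∑-++ []       ys f = sym (+-identityˡ (∑ ys f))
  ∑-++ (a ∷ as) ys f = trans (cong (f a +ℤ_) (∑-++ as ys f)) (sym (+-assoc (f a) _ _))

  ∑-map : ∀ {B : Set} (g : B → A) (xs : List B) (f : A → ℤ) → ∑ (map g xs) f ≡ ∑ xs (f ∘ g)
  ∑-map g []       f = refl
  ∑-map g (b ∷ bs) f = cong (f (g b) +ℤ_) (∑-map g bs f)

  foldr-∑ : ∀ (f : A → ℤ) (xs : List A) → foldr (λ a acc → f a +ℤ acc) (+ 0) xs ≡ ∑ xs f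
  foldr-∑ f []       = refl
  foldr-∑ f (a ∷ as) = cong (f a +ℤ_) (foldr-∑ f as)

  length-filter : ∀ (p : A → Bool) (xs : List A) → + length (filterᵇ p xs) ≡ ∑ xs (χ ∘ p)
  length-filter p []       = refl
  length-filter p (a ∷ as) with p a
  ... | true  = cong (+ 1 +ℤ_) (length-filter p as)
  ... | false = trans (length-filter p as) (sym (+-identityˡ _))

∑-swap : ∀ {A B : Set} (xs : List A) (ys : List B) (F : A → B → ℤ) →
  ∑ xs (λ a → ∑ ys (F a)) ≡ ∑ ys (λ b → ∑ xs (λ a → F a b))
∑-swap []       ys F = sym (∑-zero ys)
∑-swap (a ∷ as) ys F = trans (cong (∑ ys (F a) +ℤ_) (∑-swap as ys F)) (sym (∑-+ ys (F a) _))

∑-subsets : ∀ n (F : Subset (suc n) → ℤ) →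
  ∑ (allSubsets (suc n)) F ≡ ∑ (allSubsets n) (F ∘ (false ∷_)) +ℤ ∑ (allSubsets n) (F ∘ (true ∷_))
∑-subsets n F = trans (∑-++ (map (false ∷_) (allSubsets n)) _ F)
                      (cong₂ _+ℤ_ (∑-map (false ∷_) (allSubsets n) F) (∑-map (true ∷_) (allSubsets n) F))

∏ : ∀ {n} → (Fin n → ℤ) → ℤ
∏ {zero}  f = + 1
∏ {suc n} f = f zero * ∏ (f ∘ suc)

∏-cong : ∀ {n} {f g : Fin n → ℤ} → (∀ i → f i ≡ g i) → ∏ f ≡ ∏ g
∏-cong {zero}  h = refl
∏-cong {suc n} h = cong₂ _*_ (h zero) (∏-cong (h ∘ suc))

allSubsets-complete : ∀ {n} (y : Vec Bool n) → y ∈ allSubsets n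
allSubsets-complete []              = here refl
allSubsets-complete {suc n} (false ∷ y) = ∈-++⁺ˡ (∈-map⁺ (false ∷_) (allSubsets-complete y))
allSubsets-complete {suc n} (true ∷ y)  =
  ∈-++⁺ʳ (map (false ∷_) (allSubsets n)) (∈-map⁺ (true ∷_) (allSubsets-complete y))

allSubsets-unique : ∀ n → Unique (allSubsets n)
allSubsets-unique zero    = []ᴬ ∷ []
allSubsets-unique (suc n) =
  Unique.++⁺ (Unique.map⁺ ∷-injectiveʳ (allSubsets-unique n))
             (Unique.map⁺ ∷-injectiveʳ (allSubsets-unique n)) disjoint
  where
  ∷-injectiveʳ : ∀ {a} {u v : Vec Bool n} → a ∷ u ≡ a ∷ v → u ≡ v
  ∷-injectiveʳ refl = refl
  disjoint : ∀ {v} → ¬ (v ∈ map (false ∷_) (allSubsets n) × v ∈ map (true ∷_) (allSubsets n))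
  disjoint (v₀ , v₁) with ∈-map⁻ (false ∷_) v₀ | ∈-map⁻ (true ∷_) v₁
  ... | _ , _ , refl | _ , _ , ()

_⊆ᵇ_ : ∀ {n} → Subset n → Subset n → Bool
I ⊆ᵇ S = allF λ i → not (lookup I i) ∨ lookup S i

⊆ᵇ-∷ : ∀ {n} a b (I S : Subset n) → (a ∷ I) ⊆ᵇ (b ∷ S) ≡ (not a ∨ b) ∧ I ⊆ᵇ S
⊆ᵇ-∷ a b I S = allF-suc (λ i → not (lookup (a ∷ I) i) ∨ lookup (b ∷ S) i)

nonemptyᵇ-∷ : ∀ {n} a (I : Subset n) → nonemptyᵇ (a ∷ I) ≡ a ∨ nonemptyᵇ I
nonemptyᵇ-∷ a I = anyF-suc (lookup (a ∷ I))

coefficient : ∀ {n} → Subset n → ℤ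
coefficient I = if nonemptyᵇ I then -1ℤ ^ℤ (∣ I ∣ ∸ 1) else + 0

alternating-sum : ∀ {n} (S : Subset n) →
  ∑ (allSubsets n) (λ I → -1ℤ ^ℤ ∣ I ∣ * χ (I ⊆ᵇ S)) ≡ χ (not (nonemptyᵇ S))
alternating-sum []              = refl
alternating-sum {suc n} (b ∷ S) =
  trans (∑-subsets n _) (trans (cong₂ _+ℤ_ without-0 (with-0 b)) (combine b))
  where
  L : List (Subset n)
  L = allSubsets n
  empty : ℤ
  empty = χ (not (nonemptyᵇ S))
  without-0 : ∑ L (λ I → -1ℤ ^ℤ ∣ I ∣ * χ ((false ∷ I) ⊆ᵇ (b ∷ S))) ≡ empty
  without-0 = trans (∑-cong L λ I → cong (λ t → -1ℤ ^ℤ ∣ I ∣ * χ t) (⊆ᵇ-∷ false b I S))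
                    (alternating-sum S)
  -- A subset containing 0 contributes only if 0 ∈ S, with the opposite sign.
  with-0 : ∀ b → ∑ L (λ I → -1ℤ * -1ℤ ^ℤ ∣ I ∣ * χ ((true ∷ I) ⊆ᵇ (b ∷ S))) ≡ (if b then - empty else + 0)
  with-0 false = trans (∑-cong L λ I → trans (cong (λ t → -1ℤ * -1ℤ ^ℤ ∣ I ∣ * χ t) (⊆ᵇ-∷ true false I S))
                                             (*-zeroʳ (-1ℤ * -1ℤ ^ℤ ∣ I ∣)))
                       (∑-zero L)
  with-0 true  = trans (∑-cong L λ I → trans (cong (λ t → -1ℤ * -1ℤ ^ℤ ∣ I ∣ * χ t) (⊆ᵇ-∷ true true I S))
                                             (*-assoc -1ℤ (-1ℤ ^ℤ ∣ I ∣) _))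
                       (trans (∑-scale -1ℤ L _) (trans (-1*i≡-i _) (cong -_ (alternating-sum S))))
  combine : ∀ b → empty +ℤ (if b then - empty else + 0) ≡ χ (not (nonemptyᵇ (b ∷ S)))
  combine false = trans (+-identityʳ empty) (cong (χ ∘ not) (sym (nonemptyᵇ-∷ false S)))
  combine true  = trans (+-inverseʳ empty) (cong (χ ∘ not) (sym (nonemptyᵇ-∷ true S)))

inclusion-exclusion : ∀ {n} (S : Subset n) →
  ∑ (allSubsets n) (λ I → coefficient I * χ (I ⊆ᵇ S)) ≡ χ (nonemptyᵇ S)
inclusion-exclusion []              = refl
inclusion-exclusion {suc n} (b ∷ S) =
  trans (∑-subsets n _) (trans (cong₂ _+ℤ_ without-0 (with-0 b)) (combine b))
  where
  L : List (Subset n)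
  L = allSubsets n
  without-0 : ∑ L (λ I → coefficient (false ∷ I) * χ ((false ∷ I) ⊆ᵇ (b ∷ S))) ≡ χ (nonemptyᵇ S)
  without-0 = trans (∑-cong L λ I → cong₂ (λ e t → (if e then -1ℤ ^ℤ (∣ I ∣ ∸ 1) else + 0) * χ t)
                                          (nonemptyᵇ-∷ false I) (⊆ᵇ-∷ false b I S))
                    (inclusion-exclusion S)
  -- Subsets containing 0 have coefficient (-1)^{|I|} in terms of their remainder I.
  with-0 : ∀ b → ∑ L (λ I → coefficient (true ∷ I) * χ ((true ∷ I) ⊆ᵇ (b ∷ S)))
                 ≡ (if b then χ (not (nonemptyᵇ S)) else + 0)
  with-0 false = trans (∑-cong L λ I → trans (cong (λ t → coefficient (true ∷ I) * χ t) (⊆ᵇ-∷ true false I S))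
                                             (*-zeroʳ (coefficient (true ∷ I))))
                       (∑-zero L)
  with-0 true  = trans (∑-cong L λ I → cong₂ (λ e t → (if e then -1ℤ ^ℤ ∣ I ∣ else + 0) * χ t)
                                             (nonemptyᵇ-∷ true I) (⊆ᵇ-∷ true true I S))
                       (alternating-sum S)
  χ-excluded-middle : ∀ t → χ t +ℤ χ (not t) ≡ + 1
  χ-excluded-middle true  = refl
  χ-excluded-middle false = refl
  combine : ∀ b → χ (nonemptyᵇ S) +ℤ (if b then χ (not (nonemptyᵇ S)) else + 0) ≡ χ (nonemptyᵇ (b ∷ S))
  combine false = trans (+-identityʳ _) (cong χ (sym (nonemptyᵇ-∷ false S)))
  combine true  = trans (χ-excluded-middle (nonemptyᵇ S)) (cong χ (sym (nonemptyᵇ-∷ true S)))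

count-product : ∀ {n} (Q : Fin n → Bool → Bool) →
  ∑ (allSubsets n) (λ y → χ (allF λ j → Q j (lookup y j))) ≡ ∏ (λ j → χ (Q j false) +ℤ χ (Q j true))
count-product {zero}  Q = refl
count-product {suc n} Q =
  trans (∑-subsets n _)
        (trans (cong₂ _+ℤ_ (first false) (first true))
               (sym (*-distribʳ-+ (∏ λ j → χ (Q (suc j) false) +ℤ χ (Q (suc j) true))
                                   (χ (Q zero false)) (χ (Q zero true)))))
  where
  L : List (Subset n)
  L = allSubsets n
  rest : Vec Bool n → ℤ
  rest y = χ (allF λ j → Q (suc j) (lookup y j))
  first : ∀ b → ∑ L (λ y → χ (allF λ j → Q j (lookup (b ∷ y) j)))
                ≡ χ (Q zero b) * ∏ (λ j → χ (Q (suc j) false) +ℤ χ (Q (suc j) true))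
  first b = trans (∑-cong L λ y → trans (cong χ (allF-suc λ j → Q j (lookup (b ∷ y) j)))
                                        (χ-∧ (Q zero b) (allF λ j → Q (suc j) (lookup y j))))
                  (trans (∑-scale (χ (Q zero b)) L rest) (cong (χ (Q zero b) *_) (count-product (Q ∘ suc))))

product-of-choices : ∀ {n} (I A : Fin n → Bool) →
  ∏ (λ j → χ (not (I j)) +ℤ χ (A j))
    ≡ (if allF (λ j → not (I j) ∨ A j) then + (2 ^ℕ ∣ tabulate (λ j → not (I j) ∧ A j) ∣) else + 0)
product-of-choices {zero}  I A = refl
product-of-choices {suc n} I A rewrite allF-suc (λ j → not (I j) ∨ A j) with I zero | A zero
... | true  | true  = trans (*-identityˡ _) (product-of-choices (I ∘ suc) (A ∘ suc))
... | true  | false = refl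
... | false | true  = trans (cong (+ 2 *_) (product-of-choices (I ∘ suc) (A ∘ suc)))
                                (double (allF λ j → not (I (suc j)) ∨ A (suc j))
                                        ∣ tabulate (λ j → not (I (suc j)) ∧ A (suc j)) ∣)
  where
  double : ∀ b k → + 2 * (if b then + (2 ^ℕ k) else + 0) ≡ (if b then + (2 ^ℕ suc k) else + 0)
  double true  k = sym (pos-* 2 (2 ^ℕ k))
  double false k = refl
... | false | false = trans (*-identityˡ _) (product-of-choices (I ∘ suc) (A ∘ suc))

monotone-path : ∀ {n} (g : Vec Bool n → Bool) (u w : Vec Bool n) →
  (∀ j z → lookup u j ≢ lookup w j → g (z [ j ]≔ lookup u j) B.≤ g (z [ j ]≔ lookup w j)) →
  g u B.≤ g w
monotone-path g []      []      step = ≤ᵇ-refl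
monotone-path g (a ∷ u) (c ∷ w) step = ≤ᵇ-trans tail head
  where
  tail : g (a ∷ u) B.≤ g (a ∷ w)
  tail = monotone-path (g ∘ (a ∷_)) u w (λ j z → step (suc j) (a ∷ z))
  head : g (a ∷ w) B.≤ g (c ∷ w)
  head with a Bool.≟ c
  ... | yes refl = ≤ᵇ-refl
  ... | no a≢c   = step zero (a ∷ w) a≢c

-- An arc (j,i) pulls the value h of coordinate i towards c = x_i as x_j is
-- moved away from a = x_j, whenever it is x-frustrated: a positive arc
-- with a ≠ c and h non-decreasing, or a negative arc with a = c and h
-- non-increasing.
pull⁺ : ∀ (h : Bool → Bool) a c → a xor c ≡ true → h false B.≤ h true →
  (c xor h (not a)) B.≤ (c xor h a)
pull⁺ h false true  _  mono = not-antitone mono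
pull⁺ h true  false _  mono = mono
pull⁺ h false false () _
pull⁺ h true  true  () _

pull⁻ : ∀ (h : Bool → Bool) a c → not (a xor c) ≡ true → h true B.≤ h false →
  (c xor h (not a)) B.≤ (c xor h a)
pull⁻ h true  true  _  mono = not-antitone mono
pull⁻ h false false _  mono = mono
pull⁻ h false true  () _
pull⁻ h true  false () _

-- Reading b ↦ b xor c along an arc of a given sign respects F(D,2)'s
-- monotonicity constraints exactly in these cases.
Compatible : Sign → Bool → Set
Compatible pos c = c ≡ false
Compatible neg c = c ≡ true
Compatible zer c = ⊤

record Reading {n} (D : SignedDigraph n) (i : Fin n) : Set where
  constructor reading
  field
    source     : Fin n
    offset     : Bool
    sign       : Sign
    arc        : D source i ≡ just sign
    compatible : Compatible sign offset

open Reading using (source; offset)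

Rule : ∀ {n} → SignedDigraph n → Fin n → Set
Rule D i = Bool ⊎ Reading D i

apply : ∀ {n} {D : SignedDigraph n} {i} → Rule D i → Config n → Bool
apply (inj₁ b) z = b
apply (inj₂ r) z = lookup z (source r) xor offset r

ruleMap : ∀ {n} {D : SignedDigraph n} → (∀ i → Rule D i) → Config n → Config n
ruleMap ρ z = tabulate λ i → apply (ρ i) z

module _ {n} {D : SignedDigraph n} where

  signed⇒arc : ∀ {j i s} → D j i ≡ just s → isArc D j i ≡ true
  signed⇒arc {j} {i} eq with D j i
  signed⇒arc refl | .(just _) = refl

  apply-local : ∀ {i} (ρ : Rule D i) {z z′} →
    (∀ j → InN D i j → lookup z j ≡ lookup z′ j) → apply ρ z ≡ apply ρ z′
  apply-local (inj₁ b) agree = refl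
  apply-local (inj₂ r) agree = cong (_xor offset r) (agree (source r) (signed⇒arc (Reading.arc r)))

  apply-update : ∀ {i} (ρ : Rule D i) k z (lo hi : Bool) →
    (∀ (r : Reading D i) → source r ≡ k → (lo xor offset r) B.≤ (hi xor offset r)) →
    apply ρ (z [ k ]≔ lo) B.≤ apply ρ (z [ k ]≔ hi)
  apply-update (inj₁ b) k z lo hi readMono = ≤ᵇ-refl
  apply-update (inj₂ r) k z lo hi readMono with k Fin.≟ source r
  ... | yes refl rewrite lookup∘update k z lo | lookup∘update k z hi = readMono r refl
  ... | no k≢j   = ≤ᵇ-reflexive (cong (_xor offset r)
                     (trans (lookup∘update′ (k≢j ∘ sym) z lo) (sym (lookup∘update′ (k≢j ∘ sym) z hi))))

  offset-pos : ∀ {i} (r : Reading D i) → D (source r) i ≡ just pos → offset r ≡ false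
  offset-pos (reading _ _ pos _ c) _  = c
  offset-pos (reading _ _ neg a _) eq with () ← trans (sym a) eq
  offset-pos (reading _ _ zer a _) eq with () ← trans (sym a) eq

  offset-neg : ∀ {i} (r : Reading D i) → D (source r) i ≡ just neg → offset r ≡ true
  offset-neg (reading _ _ neg _ c) _  = c
  offset-neg (reading _ _ pos a _) eq with () ← trans (sym a) eq
  offset-neg (reading _ _ zer a _) eq with () ← trans (sym a) eq

  ruleMap∈F : (ρ : ∀ i → Rule D i) → InF D (ruleMap ρ)
  ruleMap∈F ρ = local , mono⁺ , mono⁻
    where
    value : ∀ z i → lookup (ruleMap ρ z) i ≡ apply (ρ i) z
    value z i = lookup∘tabulate (λ i → apply (ρ i) z) i
    local : ∀ i z z′ → (∀ j → InN D i j → lookup z j ≡ lookup z′ j) →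
            lookup (ruleMap ρ z) i ≡ lookup (ruleMap ρ z′) i
    local i z z′ agree = trans (value z i) (trans (apply-local (ρ i) agree) (sym (value z′ i)))
    mono⁺ : ∀ i k z → D k i ≡ just pos →
            lookup (ruleMap ρ (z [ k ]≔ false)) i B.≤ lookup (ruleMap ρ (z [ k ]≔ true)) i
    mono⁺ i k z dk = subst₂ B._≤_ (sym (value _ i)) (sym (value _ i))
      (apply-update (ρ i) k z false true λ { r refl → subst (λ c → (false xor c) B.≤ (true xor c))
                                                        (sym (offset-pos r dk)) B.f≤t })
    mono⁻ : ∀ i k z → D k i ≡ just neg →
            lookup (ruleMap ρ (z [ k ]≔ true)) i B.≤ lookup (ruleMap ρ (z [ k ]≔ false)) i
    mono⁻ i k z dk = subst₂ B._≤_ (sym (value _ i)) (sym (value _ i))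
      (apply-update (ρ i) k z true false λ { r refl → subst (λ c → (true xor c) B.≤ (false xor c))
                                                        (sym (offset-neg r dk)) B.f≤t })

-- Coordinate j may take a value b subject to "j ∈ I → b flipped" and
-- "b flipped → t": there are [j ∉ I] + [t] such values.
flip-choices : ∀ a c t →
  χ ((not a ∨ (c xor false)) ∧ (not (c xor false) ∨ t)) +ℤ χ ((not a ∨ (c xor true)) ∧ (not (c xor true) ∨ t))
    ≡ χ (not a) +ℤ χ t
flip-choices true  true  true  = refl
flip-choices true  true  false = refl
flip-choices true  false true  = refl
flip-choices true  false false = refl
flip-choices false true  true  = refl
flip-choices false true  false = refl
flip-choices false false true  = refl
flip-choices false false false = refl

absorb-vacuous : ∀ a c t → (c ≡ false → t ≡ true) → (not a ∧ t) ∧ not c ≡ not (c ∨ a)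
absorb-vacuous a     true  t _ = Bool.∧-zeroʳ (not a ∧ t)
absorb-vacuous true  false t _ = refl
absorb-vacuous false false t h rewrite h refl = refl

if-product : ∀ (a b : Bool) (s v : ℤ) →
  (if a then s else + 0) * (if b then v else + 0) ≡ (if a ∧ b then s * v else + 0)
if-product true  true  s v = refl
if-product true  false s v = *-zeroʳ s
if-product false b     s v = refl

module Guessing {n : ℕ} (D : SignedDigraph n) (x : Config n) where

  flips : Config n → Fin n → Bool
  flips y j = lookup x j xor lookup y j

  flippedArcFrustrated : Config n → Fin n → Fin n → Bool
  flippedArcFrustrated y i j = not (isArc D j i ∧ flips y j) ∨ okArc D x j i

  certifies : Config n → Fin n → Bool
  certifies y i = flips y i ∧ allF (flippedArcFrustrated y i)

  certificates : Config n → Subset n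
  certificates y = tabulate (certifies y)

  adjacentᵇ : Config n → Bool
  adjacentᵇ y = nonemptyᵇ (certificates y)

  certificates-at : ∀ y i → lookup (certificates y) i ≡ certifies y i
  certificates-at y = lookup∘tabulate (certifies y)

  CommonFixedPoint : Config n → Set
  CommonFixedPoint y = Σ (Config n → Config n) λ f → InF D f × f x ≡ x × f y ≡ y

  non-arc-ok : ∀ j i → isArc D j i ≡ false → okArc D x j i ≡ true
  non-arc-ok j i h with D j i
  ... | nothing = refl
  non-arc-ok j i () | just _

  ok-if-arc : ∀ j i → (isArc D j i ≡ true → okArc D x j i ≡ true) → okArc D x j i ≡ true
  ok-if-arc j i ok with isArc D j i in arc
  ... | true  = ok refl
  ... | false = non-arc-ok j i arc

  -- An x-frustrated arc (j,i) pulls f_i towards x_i: moving z_j away from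
  -- x_j never moves f_i(z) away from x_i.
  frustrated-arc-pulls : ∀ {f} → InF D f → ∀ i j → isArc D j i ≡ true → okArc D x j i ≡ true → ∀ z →
    (lookup x i xor lookup (f (z [ j ]≔ not (lookup x j))) i) B.≤ (lookup x i xor lookup (f (z [ j ]≔ lookup x j)) i)
  frustrated-arc-pulls {f} (_ , mono⁺ , mono⁻) i j arc frustrated z with D j i in sign
  ... | just pos = pull⁺ (λ b → lookup (f (z [ j ]≔ b)) i) (lookup x j) (lookup x i) frustrated (mono⁺ i j z sign)
  ... | just neg = pull⁻ (λ b → lookup (f (z [ j ]≔ b)) i) (lookup x j) (lookup x i) frustrated (mono⁻ i j z sign)
  frustrated-arc-pulls _ i j arc () z | just zer
  frustrated-arc-pulls _ i j () frustrated z | nothing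

  -- Let w agree with y on
  -- the in-neighbours of i and with x elsewhere; f_i(w) = f_i(y) = y_i, but
  -- on the way from w to x every change is along a frustrated arc, so
  -- "f_i ≠ x_i" cannot go from true (at w) to false (at x).
  certificate-blocks : ∀ y i → certifies y i ≡ true → ¬ CommonFixedPoint y
  certificate-blocks y i cert (f , inF , fx , fy) =
    true≰false (subst₂ B._≤_ g-w g-x (monotone-path g w x step))
    where
    g : Config n → Bool
    g z = lookup x i xor lookup (f z) i
    w : Config n
    w = tabulate λ j → if isArc D j i then lookup y j else lookup x j
    w-at : ∀ j → lookup w j ≡ (if isArc D j i then lookup y j else lookup x j)
    w-at = lookup∘tabulate _
    g-w : g w ≡ true
    g-w = begin
      lookup x i xor lookup (f w) i ≡⟨ cong (lookup x i xor_) (proj₁ inF i w y agree) ⟩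
      lookup x i xor lookup (f y) i ≡⟨ cong (λ v → lookup x i xor lookup v i) fy ⟩
      flips y i                     ≡⟨ ∧-conicalˡ _ _ cert ⟩
      true                          ∎
      where
      open ≡-Reasoning
      agree : ∀ j → InN D i j → lookup w j ≡ lookup y j
      agree j arc = trans (w-at j) (cong (λ b → if b then lookup y j else lookup x j) arc)
    g-x : g x ≡ false
    g-x = trans (cong (λ v → lookup x i xor lookup v i) fx) (xor-same (lookup x i))
    changed : ∀ j → lookup w j ≢ lookup x j → isArc D j i ≡ true × lookup w j ≡ lookup y j
    changed j w≢x with isArc D j i in arc
    ... | true  = refl , trans (w-at j) (cong (λ b → if b then lookup y j else lookup x j) arc)
    ... | false = ⊥-elim (w≢x (trans (w-at j) (cong (λ b → if b then lookup y j else lookup x j) arc)))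
    step : ∀ j z → lookup w j ≢ lookup x j → g (z [ j ]≔ lookup w j) B.≤ g (z [ j ]≔ lookup x j)
    step j z w≢x = subst (λ b → g (z [ j ]≔ b) B.≤ g (z [ j ]≔ lookup x j)) (sym w-flipped)
                         (frustrated-arc-pulls {f} inF i j arc frustrated z)
      where
      arc : isArc D j i ≡ true
      arc = proj₁ (changed j w≢x)
      w-flipped : lookup w j ≡ not (lookup x j)
      w-flipped = Bool.¬-not w≢x
      flipped : flips y j ≡ true
      flipped = trans (cong (lookup x j xor_) (trans (sym (proj₂ (changed j w≢x))) w-flipped))
                      (Bool.xor-inverseʳ (lookup x j))
      frustrated : okArc D x j i ≡ true
      frustrated = ⇒ᵇ-elim (allF-elim _ (∧-conicalʳ _ _ cert) j) (∧-intro arc flipped)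

  data Blocked (y : Config n) (i : Fin n) : Set where
    unchanged : flips y i ≡ false → Blocked y i
    blocked   : ∀ j → isArc D j i ≡ true → flips y j ≡ true → okArc D x j i ≡ false →
                flips y i ≡ true → Blocked y i

  blocked? : ∀ y i → certifies y i ≡ false → Blocked y i
  blocked? y i notCert = decide (flips y i) refl
    where
    decide : ∀ b → flips y i ≡ b → Blocked y i
    decide false same    = unchanged same
    decide true  flipped =
      let (j , fails)      = allF-counterexample _ (∧-falseʳ flipped notCert)
          (arc , fj , unfr) = ⇒ᵇ-fails _ _ _ fails
      in blocked j arc fj unfr flipped

  unfrustrated-sign : ∀ {j i} → isArc D j i ≡ true → okArc D x j i ≡ false →
    Σ Sign λ s → D j i ≡ just s × Compatible s (lookup x j xor lookup x i)
  unfrustrated-sign {j} {i} arc unfr with D j i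
  ... | just pos = pos , refl , unfr
  ... | just neg = neg , refl , Bool.not-injective {y = true} unfr
  ... | just zer = zer , refl , tt
  unfrustrated-sign () unfr | nothing

  -- The rule for coordinate i: keep x_i, or copy/negate the blocking in-neighbour
  -- so that x_j ↦ x_i (and hence y_j = ¬x_j ↦ ¬x_i = y_i).
  fixingRule : ∀ {y i} → Blocked y i → Rule D i
  fixingRule {i = i} (unchanged _)            = inj₁ (lookup x i)
  fixingRule {i = i} (blocked j arc _ unfr _) =
    let (s , sign , c) = unfrustrated-sign arc unfr
    in inj₂ (reading j (lookup x j xor lookup x i) s sign c)

  fixingRule-x : ∀ {y i} (b : Blocked y i) → apply (fixingRule b) x ≡ lookup x i
  fixingRule-x         (unchanged _)         = refl
  fixingRule-x {i = i} (blocked j _ _ _ _) = xor-cancelˡ (lookup x j) (lookup x i)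

  fixingRule-y : ∀ {y i} (b : Blocked y i) → apply (fixingRule b) y ≡ lookup y i
  fixingRule-y         (unchanged same)      = xor⇒≡ same
  fixingRule-y {y} {i} (blocked j _ fj _ fi) = begin
    lookup y j xor (lookup x j xor lookup x i)       ≡⟨ cong (_xor (lookup x j xor lookup x i)) (xor⇒flipped {lookup x j} fj) ⟩
    not (lookup x j) xor (lookup x j xor lookup x i) ≡⟨ sym (not-distribˡ-xor (lookup x j) _) ⟩
    not (lookup x j xor (lookup x j xor lookup x i)) ≡⟨ cong not (xor-cancelˡ (lookup x j) (lookup x i)) ⟩
    not (lookup x i)                                 ≡⟨ sym (xor⇒flipped {lookup x i} fi) ⟩
    lookup y i                                       ∎
    where open ≡-Reasoning

  no-certificate⇒common-fixed-point : ∀ y → (∀ i → certifies y i ≡ false) → CommonFixedPoint y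
  no-certificate⇒common-fixed-point y none =
    ruleMap ρ , ruleMap∈F ρ , fixes x fixingRule-x , fixes y fixingRule-y
    where
    ρ : ∀ i → Rule D i
    ρ i = fixingRule (blocked? y i (none i))
    fixes : ∀ z → (∀ {i} (b : Blocked y i) → apply (fixingRule b) z ≡ lookup z i) → ruleMap ρ z ≡ z
    fixes z h = trans (tabulate-cong λ i → h (blocked? y i (none i))) (tabulate∘lookup z)

  adjacent⇔certified : ∀ y → Adjacent D x y ⇔ adjacentᵇ y ≡ true
  adjacent⇔certified y = mk⇔ to from
    where
    to : Adjacent D x y → adjacentᵇ y ≡ true
    to (_ , noCommon) with adjacentᵇ y in e
    ... | true  = refl
    ... | false = ⊥-elim (noCommon (no-certificate⇒common-fixed-point y λ i →
                    trans (sym (certificates-at y i)) (anyF-none _ e i)))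
    from : adjacentᵇ y ≡ true → Adjacent D x y
    from h = x≢y , certificate-blocks y i cert
      where
      i : Fin n
      i = proj₁ (anyF-witness (lookup (certificates y)) h)
      cert : certifies y i ≡ true
      cert = trans (sym (certificates-at y i)) (proj₂ (anyF-witness (lookup (certificates y)) h))
      x≢y : x ≢ y
      x≢y x≡y with () ← trans (sym (xor-same (lookup x i)))
                              (subst (λ v → lookup x i xor lookup v i ≡ true) (sym x≡y) (∧-conicalˡ _ _ cert))

  frustratedInto : Subset n → Fin n → Fin n → Bool
  frustratedInto I j i = not (lookup I i) ∨ okArc D x j i

  frustratesInto : Subset n → Fin n → Bool
  frustratesInto I j = allF (frustratedInto I j)

  admissible : Subset n → Fin n → Bool → Bool
  admissible I j b = (not (lookup I j) ∨ (lookup x j xor b)) ∧ (not (lookup x j xor b) ∨ frustratesInto I j)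

  containment-is-product : ∀ I y → I ⊆ᵇ certificates y ≡ allF (λ j → admissible I j (lookup y j))
  containment-is-product I y = ⇔→≡ (mk⇔ to from)
    where
    to : I ⊆ᵇ certificates y ≡ true → allF (λ j → admissible I j (lookup y j)) ≡ true
    to h = allF-intro _ λ j →
      ∧-intro (⇒ᵇ-intro λ j∈I → ∧-conicalˡ _ _ (certified j j∈I))
              (⇒ᵇ-intro λ fj → allF-intro (frustratedInto I j) λ i → ⇒ᵇ-intro λ i∈I → ok-if-arc j i λ arc →
                 ⇒ᵇ-elim (allF-elim (flippedArcFrustrated y i) (∧-conicalʳ _ _ (certified i i∈I)) j)
                         (∧-intro arc fj))
      where
      certified : ∀ i → lookup I i ≡ true → certifies y i ≡ true
      certified i i∈I = trans (sym (certificates-at y i)) (⇒ᵇ-elim (allF-elim _ h i) i∈I)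
    from : allF (λ j → admissible I j (lookup y j)) ≡ true → I ⊆ᵇ certificates y ≡ true
    from h = allF-intro _ λ i → ⇒ᵇ-intro λ i∈I → trans (certificates-at y i)
      (∧-intro (⇒ᵇ-elim (∧-conicalˡ _ _ (adm i)) i∈I)
               (allF-intro (flippedArcFrustrated y i) λ j → ⇒ᵇ-intro λ arc∧fj →
                  ⇒ᵇ-elim (allF-elim (frustratedInto I j)
                                     (flipped⇒frustrates j (∧-conicalʳ (isArc D j i) (flips y j) arc∧fj)) i)
                          i∈I))
      where
      adm : ∀ j → admissible I j (lookup y j) ≡ true
      adm = allF-elim _ h
      flipped⇒frustrates : ∀ j → flips y j ≡ true → frustratesInto I j ≡ true
      flipped⇒frustrates j = ⇒ᵇ-elim (∧-conicalʳ (not (lookup I j) ∨ flips y j) _ (adm j))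

  frustrated-iff : ∀ I → allF (λ j → not (lookup I j) ∨ frustratesInto I j) ≡ inducedFrustrated D x I
  frustrated-iff I = ⇔→≡ (mk⇔ to from)
    where
    arcOk : Fin n → Fin n → Bool
    arcOk j i = not (lookup I j ∧ lookup I i) ∨ okArc D x j i
    to : allF (λ j → not (lookup I j) ∨ frustratesInto I j) ≡ true → inducedFrustrated D x I ≡ true
    to h = allF-intro _ λ j → allF-intro (arcOk j) λ i → ⇒ᵇ-intro λ j∈I∧i∈I →
      ⇒ᵇ-elim (allF-elim (frustratedInto I j) (⇒ᵇ-elim (allF-elim _ h j) (∧-conicalˡ _ _ j∈I∧i∈I)) i)
              (∧-conicalʳ _ _ j∈I∧i∈I)
    from : inducedFrustrated D x I ≡ true → allF (λ j → not (lookup I j) ∨ frustratesInto I j) ≡ true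
    from h = allF-intro (λ j → not (lookup I j) ∨ frustratesInto I j) λ j → ⇒ᵇ-intro λ j∈I →
             allF-intro (frustratedInto I j) λ i → ⇒ᵇ-intro λ i∈I →
      ⇒ᵇ-elim (allF-elim (arcOk j) (allF-elim (λ j → allF (arcOk j)) h j) i) (∧-intro j∈I i∈I)

  outside-N-frustrates : ∀ I j → lookup (NSet D I) j ≡ false → frustratesInto I j ≡ true
  outside-N-frustrates I j outside = allF-intro _ λ i → ⇒ᵇ-intro λ i∈I →
    non-arc-ok j i (∧-falseʳ i∈I (anyF-none _ noArc i))
    where
    noArc : anyF (λ i → lookup I i ∧ isArc D j i) ≡ false
    noArc = trans (sym (lookup∘tabulate (λ j → anyF λ i → lookup I i ∧ isArc D j i) j)) outside

  free-coordinates : ∀ I →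
    ∣ tabulate (λ j → not (lookup I j) ∧ frustratesInto I j) ∣ ≡ (n ∸ ∣ NSet D I ∪ I ∣) +ℕ ∣ NSetX D I x ∣
  free-coordinates I = begin
    ∣ tabulate F ∣                                                     ≡⟨ count-split F N ⟩
    ∣ tabulate (λ j → F j ∧ N j) ∣ +ℕ ∣ tabulate (λ j → F j ∧ not (N j)) ∣ ≡⟨ cong₂ _+ℕ_ inside outside ⟩
    ∣ NSetX D I x ∣ +ℕ (n ∸ ∣ NSet D I ∪ I ∣)                           ≡⟨ ℕ.+-comm ∣ NSetX D I x ∣ _ ⟩
    (n ∸ ∣ NSet D I ∪ I ∣) +ℕ ∣ NSetX D I x ∣                           ∎
    where
    open ≡-Reasoning
    F : Fin n → Bool
    F j = not (lookup I j) ∧ frustratesInto I j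
    N : Fin n → Bool
    N = lookup (NSet D I)
    inside : ∣ tabulate (λ j → F j ∧ N j) ∣ ≡ ∣ NSetX D I x ∣
    inside = cong ∣_∣ (tabulate-cong λ j →
      trans (Bool.∧-assoc (not (lookup I j)) _ _) (cong (not (lookup I j) ∧_) (Bool.∧-comm (frustratesInto I j) (N j))))
    outside : ∣ tabulate (λ j → F j ∧ not (N j)) ∣ ≡ n ∸ ∣ NSet D I ∪ I ∣
    outside = trans (cong ∣_∣ (tabulate-cong λ j →
                      trans (absorb-vacuous (lookup I j) (N j) _ (outside-N-frustrates I j))
                            (cong not (sym (lookup-zipWith _∨_ j (NSet D I) I)))))
                    (count-complement (NSet D I ∪ I))

  count-containing : ∀ I →
    ∑ (allSubsets n) (λ y → χ (I ⊆ᵇ certificates y))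
      ≡ (if inducedFrustrated D x I then + (2 ^ℕ ((n ∸ ∣ NSet D I ∪ I ∣) +ℕ ∣ NSetX D I x ∣)) else + 0)
  count-containing I = begin
    ∑ (allSubsets n) (λ y → χ (I ⊆ᵇ certificates y))
      ≡⟨ ∑-cong (allSubsets n) (λ y → cong χ (containment-is-product I y)) ⟩
    ∑ (allSubsets n) (λ y → χ (allF λ j → admissible I j (lookup y j)))
      ≡⟨ count-product (admissible I) ⟩
    ∏ (λ j → χ (admissible I j false) +ℤ χ (admissible I j true))
      ≡⟨ ∏-cong (λ j → flip-choices (lookup I j) (lookup x j) (frustratesInto I j)) ⟩
    ∏ (λ j → χ (not (lookup I j)) +ℤ χ (frustratesInto I j))
      ≡⟨ product-of-choices (lookup I) (frustratesInto I) ⟩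
    (if allF (λ j → not (lookup I j) ∨ frustratesInto I j)
       then + (2 ^ℕ ∣ tabulate (λ j → not (lookup I j) ∧ frustratesInto I j) ∣) else + 0)
      ≡⟨ cong₂ (λ b e → if b then + (2 ^ℕ e) else + 0) (frustrated-iff I) (free-coordinates I) ⟩
    (if inducedFrustrated D x I then + (2 ^ℕ ((n ∸ ∣ NSet D I ∪ I ∣) +ℕ ∣ NSetX D I x ∣)) else + 0)
      ∎
    where open ≡-Reasoning

  neighbours : List (Config n)
  neighbours = filterᵇ adjacentᵇ (allSubsets n)

  neighbours-unique : Unique neighbours
  neighbours-unique = Unique.filter⁺ (T? ∘ adjacentᵇ) (allSubsets-unique n)

  neighbours-spec : ∀ y → y ∈ neighbours ⇔ Adjacent D x y
  neighbours-spec y = mk⇔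
    (λ y∈ → from (Equivalence.to (T-≡ {adjacentᵇ y}) (proj₂ (∈-filter⁻ (T? ∘ adjacentᵇ) {xs = allSubsets n} y∈))))
    (λ adj → ∈-filter⁺ (T? ∘ adjacentᵇ) (allSubsets-complete y) (Equivalence.from (T-≡ {adjacentᵇ y}) (to adj)))
    where open Equivalence (adjacent⇔certified y)

  degree-formula : + length neighbours ≡ degreeFormula D x
  degree-formula = begin
    + length neighbours
      ≡⟨ length-filter adjacentᵇ (allSubsets n) ⟩
    ∑ (allSubsets n) (λ y → χ (adjacentᵇ y))
      ≡⟨ ∑-cong (allSubsets n) (λ y → sym (inclusion-exclusion (certificates y))) ⟩
    ∑ (allSubsets n) (λ y → ∑ (allSubsets n) (λ I → coefficient I * χ (I ⊆ᵇ certificates y)))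
      ≡⟨ ∑-swap (allSubsets n) (allSubsets n) (λ y I → coefficient I * χ (I ⊆ᵇ certificates y)) ⟩
    ∑ (allSubsets n) (λ I → ∑ (allSubsets n) (λ y → coefficient I * χ (I ⊆ᵇ certificates y)))
      ≡⟨ ∑-cong (allSubsets n) (λ I → ∑-scale (coefficient I) (allSubsets n) (λ y → χ (I ⊆ᵇ certificates y))) ⟩
    ∑ (allSubsets n) (λ I → coefficient I * ∑ (allSubsets n) (λ y → χ (I ⊆ᵇ certificates y)))
      ≡⟨ ∑-cong (allSubsets n) (λ I → trans (cong (coefficient I *_) (count-containing I))
                                            (if-product (nonemptyᵇ I) (inducedFrustrated D x I) _ _)) ⟩
    ∑ (allSubsets n) (λ I → if nonemptyᵇ I ∧ inducedFrustrated D x I then term D x I else + 0)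
      ≡⟨ sym (foldr-∑ _ (allSubsets n)) ⟩
    degreeFormula D x
      ∎
    where open ≡-Reasoning

proposition3 : (n : ℕ) (D : SignedDigraph n) (x : Config n) →
    Σ ℕ λ k → HasDegree D x k × + k ≡ degreeFormula D x
proposition3 n D x =
  length neighbours , (neighbours , neighbours-unique , neighbours-spec , refl) , degree-formula
  where open Guessing D x
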